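{- Let $p\geq 4$ be even, and let $U$ be the graph obtained from the cycle $C_p$ by adding one new vertex $v$ adjacent to exactly one vertex $c$ of the cycle. Let $\tilde{\Delta}$ be the distance squared matrix of $C_p$ (the principal submatrix of the distance squared matrix of $U$ indexed by the cycle vertices), and let $\mathbf{x}\in\mathbb{R}^p$ be the vector indexed by the cycle vertices with $x_i=(d(i,c)+1)^2$, i.e. the squared distances in $U$ from $v$ to the cycle vertices. Then $\tilde{\Delta}$ is invertible and \[ \mathbf{x}^T\tilde{\Delta}^{ -1}\mathbf{x}>0. \]
   Context: For a connected graph, the distance squared matrix $\Delta$ has $(i,j)$ entry $d_{ij}^2$, where $d_{ij}=d(i,j)$ is the shortest-path distance between vertices $i$ and $j$. -}

module Defs where

open import Data.Nat as ℕ using (ℕ; zero; suc; _⊓_; ∣_-_∣; _∸_)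
open import Data.Fin using (Fin; toℕ; zero; suc)
open import Data.Integer using (+_)
open import Data.Rational using (ℚ; 0ℚ; 1ℚ; _+_; _*_; _/_)
open import Relation.Nullary using (does)
open import Data.Fin using (_≟_)
open import Data.Bool using (if_then_else_)

-- Shortest-path distance in the cycle C_p with vertices 0,…,p-1
-- (i adjacent to i±1 mod p): d(i,j) = min(|i-j|, p-|i-j|).
cycleDist : (p : ℕ) → Fin p → Fin p → ℕ
cycleDist p i j = ∣ toℕ i - toℕ j ∣ ⊓ (p ∸ ∣ toℕ i - toℕ j ∣)

ℕ→ℚ : ℕ → ℚ
ℕ→ℚ n = (+ n) / 1

Matrix : ℕ → Set
Matrix n = Fin n → Fin n → ℚ

Vector : ℕ → Set
Vector n = Fin n → ℚ

sumFin : (n : ℕ) → (Fin n → ℚ) → ℚ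
sumFin zero    f = 0ℚ
sumFin (suc n) f = f zero + sumFin n (λ i → f (suc i))

_⊗_ : {n : ℕ} → Matrix n → Matrix n → Matrix n
_⊗_ {n} A B i j = sumFin n (λ k → A i k * B k j)

identity : (n : ℕ) → Matrix n
identity n i j = if does (i ≟ j) then 1ℚ else 0ℚ

quadForm : {n : ℕ} → Matrix n → Vector n → ℚ
quadForm {n} M x = sumFin n (λ i → sumFin n (λ j → x i * M i j * x j))

distSq : (p : ℕ) → Matrix p
distSq p i j = ℕ→ℚ (cycleDist p i j ℕ.* cycleDist p i j)

pendantVec : (p : ℕ) → Fin p → Vector p
pendantVec p c i = ℕ→ℚ (suc (cycleDist p i c) ℕ.* suc (cycleDist p i c))

module Submission where

-- Write p = 2n, S = ∑ₜ d(0,t)², and let b̄ be the antipode of b and b̄⁺, b̄⁻ its two neighbours.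
-- For fixed a, the second difference of t ↦ d(a,t)² along the cycle is 2, except at the antipode
-- of a, where it is 2 − 4n.  Hence 4nS·Δ̃⁻¹ = 2J + S·A with (Af)(b) = 2f(b̄) − f(b̄⁺) − f(b̄⁻):
-- every row of Δ̃ sums to S, so Δ̃(2J + S·A) = 2S·J + S(4n·I − 2J) = 4nS·I.  The second
-- differences of (d(c,·) + 1)² then evaluate xᵀ(2J + S·A)x to 8n²(n+1)² > 0.
-- Distances are handled through congruences: d(a,b) is the unique d ≤ n with b ≡ a ± d (mod p).

open import Defs
open import Data.Nat using (ℕ; _≤_)
open import Data.Nat.Divisibility using (_∣_)
open import Data.Fin using (Fin)
open import Data.Rational using (0ℚ; _<_)
open import Data.Product using (Σ; _×_)
open import Relation.Binary.PropositionalEquality using (_≡_)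

open import Data.Bool using (if_then_else_)
open import Data.Empty using (⊥; ⊥-elim)
open import Data.Fin as Fin using (toℕ)
import Data.Fin.Properties as FinP
open import Data.Integer as ℤ using (ℤ; +_; -[1+_]; 0ℤ)
import Data.Integer.Properties as ℤP
open import Data.Integer.Tactic.RingSolver using (solve-∀)
open import Data.Nat as ℕ using (zero; suc; _∸_; _⊓_; ∣_-_∣; z≤n; s≤s; z<s; s<s)
open import Data.Nat.Divisibility using (divides)
open import Data.Nat.DivMod using (m≡m%n+[m/n]*n; m%n<n)
import Data.Nat.Properties as ℕP
open import Data.Product using (∃-syntax; _,_; proj₁; proj₂)
open import Data.Rational as ℚ using (ℚ; 1ℚ; _/_; toℚᵘ)
import Data.Rational.Properties as ℚP
open import Data.Rational.Unnormalised as ℚᵘ using (mkℚᵘ; *≡*; *<*)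
import Data.Rational.Unnormalised.Properties as ℚᵘP
open import Data.Sum using (_⊎_; inj₁; inj₂; [_,_]′)
open import Function using (_∘_)
open import Relation.Binary.PropositionalEquality
open import Relation.Nullary using (Dec; yes; no; does)
open import Relation.Nullary.Decidable using (dec-true; dec-false)

module Summation where

  open import Data.Integer using (_+_; _*_)

  ∑ : ℕ → (ℕ → ℤ) → ℤ
  ∑ zero    F = 0ℤ
  ∑ (suc n) F = F 0 + ∑ n (λ t → F (suc t))

  ∑-cong : ∀ n {F G : ℕ → ℤ} → (∀ t → t ℕ.< n → F t ≡ G t) → ∑ n F ≡ ∑ n G
  ∑-cong zero    eq = refl
  ∑-cong (suc n) eq = cong₂ _+_ (eq 0 z<s) (∑-cong n (λ t t<n → eq (suc t) (s<s t<n)))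

  ∑-distrib-+ : ∀ n (F G : ℕ → ℤ) → ∑ n (λ t → F t + G t) ≡ ∑ n F + ∑ n G
  ∑-distrib-+ zero    F G = refl
  ∑-distrib-+ (suc n) F G =
    trans (cong (λ s → (F 0 + G 0) + s) (∑-distrib-+ n (λ t → F (suc t)) (λ t → G (suc t))))
          (interchange (F 0) (G 0) _ _)
    where
    interchange : ∀ a b c d → (a + b) + (c + d) ≡ (a + c) + (b + d)
    interchange = solve-∀

  *-distribˡ-∑ : ∀ n c (F : ℕ → ℤ) → ∑ n (λ t → c * F t) ≡ c * ∑ n F
  *-distribˡ-∑ zero    c F = sym (ℤP.*-zeroʳ c)
  *-distribˡ-∑ (suc n) c F =
    trans (cong (λ s → c * F 0 + s) (*-distribˡ-∑ n c (λ t → F (suc t))))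
          (sym (ℤP.*-distribˡ-+ c (F 0) _))

  ∑-++ : ∀ m n (F : ℕ → ℤ) → ∑ (m ℕ.+ n) F ≡ ∑ m F + ∑ n (λ t → F (m ℕ.+ t))
  ∑-++ zero    n F = sym (ℤP.+-identityˡ _)
  ∑-++ (suc m) n F =
    trans (cong (λ s → F 0 + s) (∑-++ m n (λ t → F (suc t))))
          (sym (ℤP.+-assoc (F 0) _ _))

  ∑-init-last : ∀ n (F : ℕ → ℤ) → ∑ (suc n) F ≡ ∑ n F + F n
  ∑-init-last zero    F = trans (ℤP.+-identityʳ (F 0)) (sym (ℤP.+-identityˡ (F 0)))
  ∑-init-last (suc n) F =
    trans (cong (λ s → F 0 + s) (∑-init-last n (λ t → F (suc t))))
          (sym (ℤP.+-assoc (F 0) _ _))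

  ∑-reverse : ∀ n (F : ℕ → ℤ) → ∑ n F ≡ ∑ n (λ t → F (n ∸ suc t))
  ∑-reverse zero    F = refl
  ∑-reverse (suc n) F = begin
    F 0 + ∑ n (λ t → F (suc t))
      ≡⟨ cong (λ s → F 0 + s) (∑-reverse n (λ t → F (suc t))) ⟩
    F 0 + ∑ n (λ t → F (suc (n ∸ suc t)))
      ≡⟨ cong (λ s → F 0 + s) (∑-cong n (λ t t<n → cong F (sym (ℕP.+-∸-assoc 1 t<n)))) ⟩
    F 0 + ∑ n (λ t → F (n ∸ t))
      ≡⟨ ℤP.+-comm (F 0) _ ⟩
    ∑ n (λ t → F (n ∸ t)) + F 0
      ≡⟨ cong (λ x → ∑ n (λ t → F (n ∸ t)) + F x) (ℕP.n∸n≡0 n) ⟨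
    ∑ n (λ t → F (n ∸ t)) + F (n ∸ n)
      ≡⟨ ∑-init-last n (λ t → F (n ∸ t)) ⟨
    ∑ (suc n) (λ t → F (suc n ∸ suc t)) ∎
    where open ≡-Reasoning

  ∑-zero : ∀ n (F : ℕ → ℤ) → (∀ t → t ℕ.< n → F t ≡ 0ℤ) → ∑ n F ≡ 0ℤ
  ∑-zero zero    F F≡0 = refl
  ∑-zero (suc n) F F≡0 =
    cong₂ _+_ (F≡0 0 z<s) (∑-zero n (λ t → F (suc t)) (λ t t<n → F≡0 (suc t) (s<s t<n)))

  ∑-single : ∀ n (F : ℕ → ℤ) m → m ℕ.< n → (∀ t → t ℕ.< n → t ≢ m → F t ≡ 0ℤ) → ∑ n F ≡ F m
  ∑-single (suc n) F zero    _         F≡0 =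
    trans (cong (λ s → F 0 + s) (∑-zero n _ (λ t t<n → F≡0 (suc t) (s<s t<n) λ ())))
          (ℤP.+-identityʳ (F 0))
  ∑-single (suc n) F (suc m) (s<s m<n) F≡0 =
    trans (cong₂ _+_ (F≡0 0 z<s λ ())
            (∑-single n (λ t → F (suc t)) m m<n
              (λ t t<n t≢m → F≡0 (suc t) (s<s t<n) (t≢m ∘ ℕP.suc-injective))))
          (ℤP.+-identityˡ _)

  ∑-pair : ∀ n (F : ℕ → ℤ) m₁ m₂ → m₁ ℕ.< n → m₂ ℕ.< n → m₁ ≢ m₂ →
           (∀ t → t ℕ.< n → t ≢ m₁ → t ≢ m₂ → F t ≡ 0ℤ) → ∑ n F ≡ F m₁ + F m₂
  ∑-pair (suc n) F zero    zero    _         _         0≢0 _   = ⊥-elim (0≢0 refl)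
  ∑-pair (suc n) F zero    (suc m) _         (s<s m<n) _   F≡0 =
    cong (λ s → F 0 + s) (∑-single n (λ t → F (suc t)) m m<n
      (λ t t<n t≢m → F≡0 (suc t) (s<s t<n) (λ ()) (t≢m ∘ ℕP.suc-injective)))
  ∑-pair (suc n) F (suc m) zero    (s<s m<n) _         _   F≡0 =
    trans (cong (λ s → F 0 + s) (∑-single n (λ t → F (suc t)) m m<n
            (λ t t<n t≢m → F≡0 (suc t) (s<s t<n) (t≢m ∘ ℕP.suc-injective) (λ ()))))
          (ℤP.+-comm (F 0) _)
  ∑-pair (suc n) F (suc m₁) (suc m₂) (s<s m₁<n) (s<s m₂<n) m₁≢m₂ F≡0 =
    trans (cong₂ _+_ (F≡0 0 z<s (λ ()) (λ ()))
            (∑-pair n (λ t → F (suc t)) m₁ m₂ m₁<n m₂<n (m₁≢m₂ ∘ cong suc)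
              (λ t t<n t≢m₁ t≢m₂ → F≡0 (suc t) (s<s t<n) (t≢m₁ ∘ ℕP.suc-injective) (t≢m₂ ∘ ℕP.suc-injective))))
          (ℤP.+-identityˡ _)

  ∑-nonneg : ∀ n (F : ℕ → ℤ) → (∀ t → t ℕ.< n → 0ℤ ℤ.≤ F t) → 0ℤ ℤ.≤ ∑ n F
  ∑-nonneg zero    F F≥0 = ℤP.≤-refl
  ∑-nonneg (suc n) F F≥0 =
    ℤP.+-mono-≤ (F≥0 0 z<s) (∑-nonneg n (λ t → F (suc t)) (λ t t<n → F≥0 (suc t) (s<s t<n)))

open Summation

module Fractions where

  -- z / suc d is the normal form of mkℚᵘ z d, so these identities are checked in ℚᵘ.
  private
    toℚᵘ-/ : ∀ z d → toℚᵘ (z / suc d) ℚᵘ.≃ mkℚᵘ z d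
    toℚᵘ-/ z d = ℚP.toℚᵘ-fromℚᵘ (mkℚᵘ z d)

  /-distrib-+ : ∀ a b d .{{_ : ℕ.NonZero d}} → a / d ℚ.+ b / d ≡ (a ℤ.+ b) / d
  /-distrib-+ a b (suc d) = ℚP.toℚᵘ-injective (begin
    toℚᵘ (a / suc d ℚ.+ b / suc d)        ≈⟨ ℚP.toℚᵘ-homo-+ (a / suc d) (b / suc d) ⟩
    toℚᵘ (a / suc d) ℚᵘ.+ toℚᵘ (b / suc d) ≈⟨ ℚᵘP.+-cong (toℚᵘ-/ a d) (toℚᵘ-/ b d) ⟩
    mkℚᵘ a d ℚᵘ.+ mkℚᵘ b d                ≈⟨ *≡* (trans (common a b (+ suc d)) (cong ((a ℤ.+ b) ℤ.*_) (sym (ℤP.pos-* (suc d) (suc d))))) ⟩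
    mkℚᵘ (a ℤ.+ b) d                      ≈⟨ toℚᵘ-/ (a ℤ.+ b) d ⟨
    toℚᵘ ((a ℤ.+ b) / suc d)              ∎)
    where
    open ℚᵘP.≃-Reasoning
    common : ∀ a b s → (a ℤ.* s ℤ.+ b ℤ.* s) ℤ.* s ≡ (a ℤ.+ b) ℤ.* (s ℤ.* s)
    common = solve-∀

  /1-*-/ : ∀ a z d .{{_ : ℕ.NonZero d}} → (a / 1) ℚ.* (z / d) ≡ (a ℤ.* z) / d
  /1-*-/ a z (suc d) = ℚP.toℚᵘ-injective (begin
    toℚᵘ ((a / 1) ℚ.* (z / suc d))         ≈⟨ ℚP.toℚᵘ-homo-* (a / 1) (z / suc d) ⟩
    toℚᵘ (a / 1) ℚᵘ.* toℚᵘ (z / suc d)     ≈⟨ ℚᵘP.*-cong (toℚᵘ-/ a 0) (toℚᵘ-/ z d) ⟩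
    mkℚᵘ a 0 ℚᵘ.* mkℚᵘ z d                 ≈⟨ *≡* (trans (unit (a ℤ.* z) (+ suc d)) (cong ((a ℤ.* z) ℤ.*_) (sym (ℤP.pos-* 1 (suc d))))) ⟩
    mkℚᵘ (a ℤ.* z) d                       ≈⟨ toℚᵘ-/ (a ℤ.* z) d ⟨
    toℚᵘ ((a ℤ.* z) / suc d)               ∎)
    where
    open ℚᵘP.≃-Reasoning
    unit : ∀ x s → x ℤ.* s ≡ x ℤ.* (+ 1 ℤ.* s)
    unit = solve-∀

  /-*-/1 : ∀ z a d .{{_ : ℕ.NonZero d}} → (z / d) ℚ.* (a / 1) ≡ (z ℤ.* a) / d
  /-*-/1 z a d = trans (ℚP.*-comm (z / d) (a / 1)) (trans (/1-*-/ a z d) (cong (_/ d) (ℤP.*-comm a z)))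

  n/n≡1 : ∀ d .{{_ : ℕ.NonZero d}} → (+ d) / d ≡ 1ℚ
  n/n≡1 (suc d) = ℚP.toℚᵘ-injective (ℚᵘP.≃-trans (toℚᵘ-/ (+ suc d) d) (*≡* (ℤP.*-comm (+ suc d) (+ 1))))

  positive-/ : ∀ z d .{{_ : ℕ.NonZero d}} → 0ℤ ℤ.< z → 0ℚ ℚ.< z / d
  positive-/ z (suc d) 0<z = ℚP.toℚᵘ-cancel-< (ℚᵘP.<-respʳ-≃ (ℚᵘP.≃-sym (toℚᵘ-/ z d))
    (*<* (subst₂ ℤ._<_ (sym (ℤP.*-zeroˡ (+ suc d))) (sym (ℤP.*-identityʳ z)) 0<z)))

open Fractions

module Arithmetic where

  open import Data.Integer using (_*_; _-_)

  +-∸ : ∀ {a b} → b ℕ.≤ a → + (a ∸ b) ≡ + a - + b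
  +-∸ {a} {b} b≤a = trans (sym (ℤP.⊖-≥ b≤a)) (sym (ℤP.m-n≡m⊖n a b))

  δ : ℕ → ℕ → ℤ
  δ u v = if does (u ℕ.≟ v) then + 1 else 0ℤ

  δ-refl : ∀ u → δ u u ≡ + 1
  δ-refl u rewrite dec-true (u ℕ.≟ u) refl = refl

  δ-≢ : ∀ {u v} → u ≢ v → δ u v ≡ 0ℤ
  δ-≢ {u} {v} u≢v rewrite dec-false (u ℕ.≟ v) u≢v = refl

  sq : ℕ → ℤ
  sq d = + d * + d

  positive⇒∣∣-nonZero : ∀ {i} → 0ℤ ℤ.< i → ℕ.NonZero ℤ.∣ i ∣
  positive⇒∣∣-nonZero {+ zero}  (ℤ.+<+ ())
  positive⇒∣∣-nonZero {+ suc _} _ = _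

open Arithmetic

module Cycle (m : ℕ) where

  open import Data.Integer using (_+_; _*_; _-_; -_)

  k n p : ℕ
  k = suc m
  n = suc k
  p = n ℕ.+ n

  instance
    p≢0 : ℕ.NonZero p
    p≢0 = _

  dist : ℕ → ℕ → ℕ
  dist a b = ∣ a - b ∣ ⊓ (p ∸ ∣ a - b ∣)

  infix 4 _≋_
  record _≋_ (x y : ℤ) : Set where
    constructor _,_
    field
      quotient   : ℤ
      difference : x - y ≡ quotient * + p

  ≡⇒≋ : ∀ {x y} → x ≡ y → x ≋ y
  ≡⇒≋ {x} refl = + 0 , trans (ℤP.+-inverseʳ x) (sym (ℤP.*-zeroˡ (+ p)))

  ≋-combine₁ : ∀ {x y} u v → x ≋ y → ∀ s r → u - v ≡ s * (x - y) + r * + p → u ≋ v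
  ≋-combine₁ {x} {y} u v (c , x-y≡cp) s r eq = s * c + r , (begin
    u - v                   ≡⟨ eq ⟩
    s * (x - y) + r * + p   ≡⟨ cong (λ z → s * z + r * + p) x-y≡cp ⟩
    s * (c * + p) + r * + p ≡⟨ collect s c r (+ p) ⟩
    (s * c + r) * + p       ∎)
    where
    open ≡-Reasoning
    collect : ∀ s c r P → s * (c * P) + r * P ≡ (s * c + r) * P
    collect = solve-∀

  ≋-combine₂ : ∀ {x y x′ y′} u v → x ≋ y → x′ ≋ y′ → ∀ s s′ r →
               u - v ≡ s * (x - y) + s′ * (x′ - y′) + r * + p → u ≋ v
  ≋-combine₂ {x} {y} {x′} {y′} u v (c , x-y≡cp) (c′ , x′-y′≡c′p) s s′ r eq = s * c + s′ * c′ + r , (begin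
    u - v                                     ≡⟨ eq ⟩
    s * (x - y) + s′ * (x′ - y′) + r * + p    ≡⟨ cong₂ (λ z z′ → s * z + s′ * z′ + r * + p) x-y≡cp x′-y′≡c′p ⟩
    s * (c * + p) + s′ * (c′ * + p) + r * + p ≡⟨ collect s c s′ c′ r (+ p) ⟩
    (s * c + s′ * c′ + r) * + p               ∎)
    where
    open ≡-Reasoning
    collect : ∀ s c s′ c′ r P → s * (c * P) + s′ * (c′ * P) + r * P ≡ (s * c + s′ * c′ + r) * P
    collect = solve-∀

  private
    +≋+⇒ℕ : ∀ x y → + x ≋ + y → (∃[ c ] x ≡ y ℕ.+ c ℕ.* p) ⊎ (∃[ c ] y ≡ x ℕ.+ suc c ℕ.* p)
    +≋+⇒ℕ x y (+ c , x-y≡cp) = inj₁ (c , ℤP.+-injective (begin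
      + x                  ≡⟨ add-back (+ x) (+ y) ⟩
      + y + (+ x - + y)    ≡⟨ cong (_+_ (+ y)) x-y≡cp ⟩
      + y + + c * + p      ≡⟨ cong (_+_ (+ y)) (ℤP.pos-* c p) ⟨
      + (y ℕ.+ c ℕ.* p)    ∎))
      where
      open ≡-Reasoning
      add-back : ∀ x y → x ≡ y + (x - y)
      add-back = solve-∀
    +≋+⇒ℕ x y (-[1+ c ] , x-y≡cp) = inj₂ (c , ℤP.+-injective (begin
      + y                           ≡⟨ take-back (+ x) (+ y) ⟩
      + x - (+ x - + y)             ≡⟨ cong (_-_ (+ x)) x-y≡cp ⟩
      + x - -[1+ c ] * + p          ≡⟨ cong (_+_ (+ x)) (ℤP.neg-distribˡ-* -[1+ c ] (+ p)) ⟩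
      + x + + suc c * + p           ≡⟨ cong (_+_ (+ x)) (ℤP.pos-* (suc c) p) ⟨
      + (x ℕ.+ suc c ℕ.* p)         ∎))
      where
      open ≡-Reasoning
      take-back : ∀ x y → y ≡ x - (x - y)
      take-back = solve-∀

    p≤+suc*p : ∀ y c → p ℕ.≤ y ℕ.+ suc c ℕ.* p
    p≤+suc*p y c = ℕP.≤-trans (ℕP.m≤m+n p (c ℕ.* p)) (ℕP.m≤n+m (suc c ℕ.* p) y)

  ≋⇒≡ : ∀ {x y} → x ℕ.< p → y ℕ.< p → + x ≋ + y → x ≡ y
  ≋⇒≡ {x} {y} x<p y<p x≋y with +≋+⇒ℕ x y x≋y
  ... | inj₁ (zero , x≡y+0)  = trans x≡y+0 (ℕP.+-identityʳ y)
  ... | inj₁ (suc c , x≡y+) = ⊥-elim (ℕP.<⇒≱ x<p (subst (p ℕ.≤_) (sym x≡y+) (p≤+suc*p y c)))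
  ... | inj₂ (c , y≡x+)     = ⊥-elim (ℕP.<⇒≱ y<p (subst (p ℕ.≤_) (sym y≡x+) (p≤+suc*p x c)))

  ≋0⇒≡0⊎≡p : ∀ {x} → x ℕ.≤ p → + x ≋ 0ℤ → x ≡ 0 ⊎ x ≡ p
  ≋0⇒≡0⊎≡p {x} x≤p x≋0 with +≋+⇒ℕ x 0 x≋0
  ... | inj₁ (zero , x≡0)         = inj₁ x≡0
  ... | inj₁ (suc zero , x≡p)     = inj₂ (trans x≡p (ℕP.+-identityʳ p))
  ... | inj₁ (suc (suc c) , x≡)   = ⊥-elim (ℕP.<⇒≱ (ℕP.m<m+n p (ℕP.<-≤-trans z<s (ℕP.m≤m+n p (c ℕ.* p))))
                                                   (subst (ℕ._≤ p) x≡ x≤p))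
  ... | inj₂ (c , 0≡)             = ⊥-elim (ℕP.<⇒≱ z<s (subst (p ℕ.≤_) (sym 0≡) (p≤+suc*p x c)))

  Offset : ℕ → ℕ → ℕ → Set
  Offset a b d = (+ b ≋ + a + + d) ⊎ (+ b ≋ + a - + d)

  offset-reflect : ∀ {a b e} → e ℕ.≤ p → Offset a b e → Offset a b (p ∸ e)
  offset-reflect {a} {b} {e} e≤p (inj₁ b≋a+e) = inj₂ (subst (λ z → + b ≋ + a - z) (sym (+-∸ e≤p))
    (≋-combine₁ (+ b) (+ a - (+ p - + e)) b≋a+e (+ 1) (+ 1) (wrap (+ b) (+ a) (+ e) (+ p))))
    where
    wrap : ∀ b a e P → b - (a - (P - e)) ≡ + 1 * (b - (a + e)) + + 1 * P
    wrap = solve-∀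
  offset-reflect {a} {b} {e} e≤p (inj₂ b≋a-e) = inj₁ (subst (λ z → + b ≋ + a + z) (sym (+-∸ e≤p))
    (≋-combine₁ (+ b) (+ a + (+ p - + e)) b≋a-e (+ 1) (- + 1) (wrap (+ b) (+ a) (+ e) (+ p))))
    where
    wrap : ∀ b a e P → b - (a + (P - e)) ≡ + 1 * (b - (a - e)) + - + 1 * P
    wrap = solve-∀

  private
    ⊓-reflect : ∀ {a b e} → e ℕ.≤ p → Offset a b e → e ⊓ (p ∸ e) ℕ.≤ n × Offset a b (e ⊓ (p ∸ e))
    ⊓-reflect {a} {b} {e} e≤p off with e ℕ.≤? n
    ... | yes e≤n = subst (λ d → d ℕ.≤ n × Offset a b d) (sym (ℕP.m≤n⇒m⊓n≡m e≤p-e)) (e≤n , off)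
      where
      e≤p-e : e ℕ.≤ p ∸ e
      e≤p-e = ℕP.≤-trans e≤n (subst (n ℕ.≤_) (sym (ℕP.+-∸-assoc n e≤n)) (ℕP.m≤m+n n (n ∸ e)))
    ... | no e≰n = subst (λ d → d ℕ.≤ n × Offset a b d) (sym (ℕP.m≥n⇒m⊓n≡n (ℕP.≤-trans p-e≤n n≤e)))
                         (p-e≤n , offset-reflect e≤p off)
      where
      n≤e : n ℕ.≤ e
      n≤e = ℕP.<⇒≤ (ℕP.≰⇒> e≰n)
      p-e≤n : p ∸ e ℕ.≤ n
      p-e≤n = ℕP.≤-trans (ℕP.∸-monoʳ-≤ p n≤e) (ℕP.≤-reflexive (ℕP.m+n∸n≡m n n))

  dist≤n×offset : ∀ {a b} → a ℕ.< p → b ℕ.< p → dist a b ℕ.≤ n × Offset a b (dist a b)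
  dist≤n×offset {a} {b} a<p b<p with ℕP.≤-total a b
  ... | inj₁ a≤b = subst (λ e → e ⊓ (p ∸ e) ℕ.≤ n × Offset a b (e ⊓ (p ∸ e))) (sym (ℕP.m≤n⇒∣m-n∣≡n∸m a≤b))
                     (⊓-reflect (ℕP.≤-trans (ℕP.m∸n≤m b a) (ℕP.<⇒≤ b<p))
                       (inj₁ (≡⇒≋ (cong +_ (sym (ℕP.m+[n∸m]≡n a≤b))))))
  ... | inj₂ b≤a = subst (λ e → e ⊓ (p ∸ e) ℕ.≤ n × Offset a b (e ⊓ (p ∸ e))) (sym (ℕP.m≤n⇒∣n-m∣≡n∸m b≤a))
                     (⊓-reflect (ℕP.≤-trans (ℕP.m∸n≤m a b) (ℕP.<⇒≤ a<p))
                       (inj₂ (≡⇒≋ (trans (take-back (+ a) (+ b)) (cong (_-_ (+ a)) (sym (+-∸ b≤a)))))))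
    where
    take-back : ∀ x y → y ≡ x - (x - y)
    take-back = solve-∀

  dist≤n : ∀ {a b} → a ℕ.< p → b ℕ.< p → dist a b ℕ.≤ n
  dist≤n a<p b<p = proj₁ (dist≤n×offset a<p b<p)

  dist-offset : ∀ {a b} → a ℕ.< p → b ℕ.< p → Offset a b (dist a b)
  dist-offset a<p b<p = proj₂ (dist≤n×offset a<p b<p)

  private
    n<p : n ℕ.< p
    n<p = ℕP.m<m+n n z<s

    opposite-offsets : ∀ {d d′} → d ℕ.≤ n → d′ ℕ.≤ n → + (d ℕ.+ d′) ≋ 0ℤ → d ≡ d′
    opposite-offsets {d} {d′} d≤n d′≤n d+d′≋0 with ≋0⇒≡0⊎≡p (ℕP.+-mono-≤ d≤n d′≤n) d+d′≋0
    ... | inj₁ d+d′≡0 = trans (ℕP.m+n≡0⇒m≡0 d d+d′≡0) (sym (ℕP.m+n≡0⇒n≡0 d d+d′≡0))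
    ... | inj₂ d+d′≡p = trans (half d≤n d′≤n d+d′≡p) (sym (half d′≤n d≤n (trans (ℕP.+-comm d′ d) d+d′≡p)))
      where
      half : ∀ {d d′} → d ℕ.≤ n → d′ ℕ.≤ n → d ℕ.+ d′ ≡ p → d ≡ n
      half {d} d≤n d′≤n d+d′≡p =
        ℕP.≤-antisym d≤n (ℕP.+-cancelʳ-≤ n n d (subst (ℕ._≤ d ℕ.+ n) d+d′≡p (ℕP.+-monoʳ-≤ d d′≤n)))

  offset-unique : ∀ {a b d d′} → d ℕ.≤ n → d′ ℕ.≤ n → Offset a b d → Offset a b d′ → d ≡ d′
  offset-unique {a} {b} {d} {d′} d≤n d′≤n = go
    where
    d<p : d ℕ.< p
    d<p = ℕP.≤-<-trans d≤n n<p
    d′<p : d′ ℕ.< p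
    d′<p = ℕP.≤-<-trans d′≤n n<p
    go : Offset a b d → Offset a b d′ → d ≡ d′
    go (inj₁ h) (inj₁ h′) = ≋⇒≡ d<p d′<p (≋-combine₂ (+ d) (+ d′) h h′ (- + 1) (+ 1) (+ 0) (same (+ d) (+ d′) (+ b) (+ a) (+ p)))
      where
      same : ∀ d d′ b a P → d - d′ ≡ - + 1 * (b - (a + d)) + + 1 * (b - (a + d′)) + + 0 * P
      same = solve-∀
    go (inj₂ h) (inj₂ h′) = ≋⇒≡ d<p d′<p (≋-combine₂ (+ d) (+ d′) h h′ (+ 1) (- + 1) (+ 0) (same (+ d) (+ d′) (+ b) (+ a) (+ p)))
      where
      same : ∀ d d′ b a P → d - d′ ≡ + 1 * (b - (a - d)) + - + 1 * (b - (a - d′)) + + 0 * P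
      same = solve-∀
    go (inj₁ h) (inj₂ h′) = opposite-offsets d≤n d′≤n
      (≋-combine₂ (+ d + + d′) 0ℤ h h′ (- + 1) (+ 1) (+ 0) (opposite (+ d) (+ d′) (+ b) (+ a) (+ p)))
      where
      opposite : ∀ d d′ b a P → (d + d′) - 0ℤ ≡ - + 1 * (b - (a + d)) + + 1 * (b - (a - d′)) + + 0 * P
      opposite = solve-∀
    go (inj₂ h) (inj₁ h′) = sym (opposite-offsets d′≤n d≤n
      (≋-combine₂ (+ d′ + + d) 0ℤ h′ h (- + 1) (+ 1) (+ 0) (opposite (+ d′) (+ d) (+ b) (+ a) (+ p))))
      where
      opposite : ∀ d d′ b a P → (d + d′) - 0ℤ ≡ - + 1 * (b - (a + d)) + + 1 * (b - (a - d′)) + + 0 * P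
      opposite = solve-∀

  dist-unique : ∀ {a b d} → a ℕ.< p → b ℕ.< p → d ℕ.≤ n → Offset a b d → dist a b ≡ d
  dist-unique a<p b<p d≤n = offset-unique (dist≤n a<p b<p) d≤n (dist-offset a<p b<p)

  dist-sym : ∀ a b → dist a b ≡ dist b a
  dist-sym a b rewrite ℕP.∣-∣-comm a b = refl

  dist-refl : ∀ a → dist a a ≡ 0
  dist-refl a rewrite ℕP.∣n-n∣≡0 a = refl

  dist≡0⇒≡ : ∀ {a b} → a ℕ.< p → b ℕ.< p → dist a b ≡ 0 → a ≡ b
  dist≡0⇒≡ {a} {b} a<p b<p d≡0 = sym (≋⇒≡ b<p a<p (zero-offset (subst (Offset a b) d≡0 (dist-offset a<p b<p))))
    where
    zero-offset : Offset a b 0 → + b ≋ + a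
    zero-offset (inj₁ h) = ≋-combine₁ (+ b) (+ a) h (+ 1) (+ 0) (unit (+ b) (+ a) (+ p))
      where
      unit : ∀ b a P → b - a ≡ + 1 * (b - (a + + 0)) + + 0 * P
      unit = solve-∀
    zero-offset (inj₂ h) = ≋-combine₁ (+ b) (+ a) h (+ 1) (+ 0) (unit (+ b) (+ a) (+ p))
      where
      unit : ∀ b a P → b - a ≡ + 1 * (b - (a - + 0)) + + 0 * P
      unit = solve-∀

  shift : ℕ → ℕ → ℕ
  shift s b = (b ℕ.+ s) ℕ.% p

  shift<p : ∀ s b → shift s b ℕ.< p
  shift<p s b = m%n<n (b ℕ.+ s) p

  shift-≋ : ∀ s b → + shift s b ≋ + b + + s
  shift-≋ s b = - + q , (begin
    + r - (+ b + + s)   ≡⟨ cong (λ z → + r - z) (cong +_ (m≡m%n+[m/n]*n (b ℕ.+ s) p)) ⟩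
    + r - + (r ℕ.+ q ℕ.* p) ≡⟨ cong (λ z → + r - (+ r + z)) (ℤP.pos-* q p) ⟩
    + r - (+ r + + q * + p) ≡⟨ cancel (+ r) (+ q) (+ p) ⟩
    - + q * + p         ∎)
    where
    open ≡-Reasoning
    r q : ℕ
    r = shift s b
    q = (b ℕ.+ s) ℕ./ p
    cancel : ∀ r q P → r - (r + q * P) ≡ - q * P
    cancel = solve-∀

  antipode antipode⁺ antipode⁻ : ℕ → ℕ
  antipode  b = shift n b
  antipode⁺ b = shift (suc n) b
  antipode⁻ b = shift k b

  dist-antipode : ∀ {a b} → a ℕ.< p → b ℕ.< p → dist a (antipode b) ≡ n ∸ dist a b
  dist-antipode {a} {b} a<p b<p =
    dist-unique a<p (shift<p n b) (ℕP.m∸n≤m n u) (go (dist-offset a<p b<p))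
    where
    u : ℕ
    u = dist a b
    n-u≡ : + (n ∸ u) ≡ + n - + u
    n-u≡ = +-∸ (dist≤n a<p b<p)
    go : Offset a b u → Offset a (antipode b) (n ∸ u)
    go (inj₁ h) = inj₂ (subst (λ z → + antipode b ≋ + a - z) (sym n-u≡)
      (≋-combine₂ (+ antipode b) (+ a - (+ n - + u)) (shift-≋ n b) h (+ 1) (+ 1) (+ 1)
        (rearrange (+ antipode b) (+ b) (+ a) (+ u) (+ n))))
      where
      rearrange : ∀ B̄ B A U N → B̄ - (A - (N - U)) ≡ + 1 * (B̄ - (B + N)) + + 1 * (B - (A + U)) + + 1 * (N + N)
      rearrange = solve-∀
    go (inj₂ h) = inj₁ (subst (λ z → + antipode b ≋ + a + z) (sym n-u≡)
      (≋-combine₂ (+ antipode b) (+ a + (+ n - + u)) (shift-≋ n b) h (+ 1) (+ 1) (+ 0)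
        (rearrange (+ antipode b) (+ b) (+ a) (+ u) (+ n))))
      where
      rearrange : ∀ B̄ B A U N → B̄ - (A + (N - U)) ≡ + 1 * (B̄ - (B + N)) + + 1 * (B - (A - U)) + + 0 * (N + N)
      rearrange = solve-∀

  dist-antipode-self : ∀ {b} → b ℕ.< p → dist (antipode b) b ≡ n
  dist-antipode-self {b} b<p = dist-unique (shift<p n b) b<p ℕP.≤-refl
    (inj₂ (≋-combine₁ (+ b) (+ antipode b - + n) (shift-≋ n b) (- + 1) (+ 0) (rearrange (+ b) (+ antipode b) (+ n))))
    where
    rearrange : ∀ B B̄ N → B - (B̄ - N) ≡ - + 1 * (B̄ - (B + N)) + + 0 * (N + N)
    rearrange = solve-∀

  dist≡n⇒≡antipode : ∀ {t b} → t ℕ.< p → b ℕ.< p → dist t b ≡ n → t ≡ antipode b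
  dist≡n⇒≡antipode {t} {b} t<p b<p d≡n = ≋⇒≡ t<p (shift<p n b) (go (subst (Offset t b) d≡n (dist-offset t<p b<p)))
    where
    go : Offset t b n → + t ≋ + antipode b
    go (inj₁ h) = ≋-combine₂ (+ t) (+ antipode b) h (shift-≋ n b) (- + 1) (- + 1) (- + 1)
      (rearrange (+ t) (+ antipode b) (+ b) (+ n))
      where
      rearrange : ∀ T B̄ B N → T - B̄ ≡ - + 1 * (B - (T + N)) + - + 1 * (B̄ - (B + N)) + - + 1 * (N + N)
      rearrange = solve-∀
    go (inj₂ h) = ≋-combine₂ (+ t) (+ antipode b) h (shift-≋ n b) (- + 1) (- + 1) (+ 0)
      (rearrange (+ t) (+ antipode b) (+ b) (+ n))
      where
      rearrange : ∀ T B̄ B N → T - B̄ ≡ - + 1 * (B - (T - N)) + - + 1 * (B̄ - (B + N)) + + 0 * (N + N)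
      rearrange = solve-∀

  private
    k≤n : k ℕ.≤ n
    k≤n = ℕP.n≤1+n k

  dist-antipode⁺-self : ∀ {b} → b ℕ.< p → dist (antipode⁺ b) b ≡ k
  dist-antipode⁺-self {b} b<p = dist-unique (shift<p (suc n) b) b<p k≤n
    (inj₁ (≋-combine₁ (+ b) (+ antipode⁺ b + + k) (shift-≋ (suc n) b) (- + 1) (- + 1) (rearrange (+ b) (+ antipode⁺ b) (+ k))))
    where
    rearrange : ∀ B B̄⁺ K → B - (B̄⁺ + K) ≡ - + 1 * (B̄⁺ - (B + (+ 2 + K))) + - + 1 * ((+ 1 + K) + (+ 1 + K))
    rearrange = solve-∀

  dist-antipode⁻-self : ∀ {b} → b ℕ.< p → dist (antipode⁻ b) b ≡ k
  dist-antipode⁻-self {b} b<p = dist-unique (shift<p k b) b<p k≤n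
    (inj₂ (≋-combine₁ (+ b) (+ antipode⁻ b - + k) (shift-≋ k b) (- + 1) (+ 0) (rearrange (+ b) (+ antipode⁻ b) (+ k))))
    where
    rearrange : ∀ B B̄⁻ K → B - (B̄⁻ - K) ≡ - + 1 * (B̄⁻ - (B + K)) + + 0 * ((+ 1 + K) + (+ 1 + K))
    rearrange = solve-∀

  dist≡k⇒antipode± : ∀ {t b} → t ℕ.< p → b ℕ.< p → dist t b ≡ k → t ≡ antipode⁺ b ⊎ t ≡ antipode⁻ b
  dist≡k⇒antipode± {t} {b} t<p b<p d≡k = go (subst (Offset t b) d≡k (dist-offset t<p b<p))
    where
    go : Offset t b k → t ≡ antipode⁺ b ⊎ t ≡ antipode⁻ b
    go (inj₁ h) = inj₁ (≋⇒≡ t<p (shift<p (suc n) b)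
      (≋-combine₂ (+ t) (+ antipode⁺ b) h (shift-≋ (suc n) b) (- + 1) (- + 1) (- + 1) (rearrange (+ t) (+ antipode⁺ b) (+ b) (+ k))))
      where
      rearrange : ∀ T B̄⁺ B K → T - B̄⁺ ≡ - + 1 * (B - (T + K)) + - + 1 * (B̄⁺ - (B + (+ 2 + K))) + - + 1 * ((+ 1 + K) + (+ 1 + K))
      rearrange = solve-∀
    go (inj₂ h) = inj₂ (≋⇒≡ t<p (shift<p k b)
      (≋-combine₂ (+ t) (+ antipode⁻ b) h (shift-≋ k b) (- + 1) (- + 1) (+ 0) (rearrange (+ t) (+ antipode⁻ b) (+ b) (+ k))))
      where
      rearrange : ∀ T B̄⁻ B K → T - B̄⁻ ≡ - + 1 * (B - (T - K)) + - + 1 * (B̄⁻ - (B + K)) + + 0 * ((+ 1 + K) + (+ 1 + K))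
      rearrange = solve-∀

  -- This is where p ≥ 4 is needed: for p = 2 both neighbours of the antipode coincide.
  antipode⁺≢antipode⁻ : ∀ b → antipode⁺ b ≢ antipode⁻ b
  antipode⁺≢antipode⁻ b eq = 2≢0∧2≢p (≋0⇒≡0⊎≡p 2≤p two≋0)
    where
    2≤p : 2 ℕ.≤ p
    2≤p = s≤s (s≤s z≤n)
    2≢0∧2≢p : 2 ≡ 0 ⊎ 2 ≡ p → ⊥
    2≢0∧2≢p (inj₁ ())
    2≢0∧2≢p (inj₂ 2≡p) = ℕP.<⇒≢ (s≤s (s≤s (s≤s z≤n))) (trans 2≡p (ℕP.+-suc n k))
    rearrange : ∀ B B̄⁻ K → + 2 - 0ℤ ≡ - + 1 * (B̄⁻ - (B + (+ 2 + K))) + + 1 * (B̄⁻ - (B + K)) + + 0 * ((+ 1 + K) + (+ 1 + K))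
    rearrange = solve-∀
    two≋0 : + 2 ≋ 0ℤ
    two≋0 = ≋-combine₂ (+ 2) 0ℤ (subst (λ z → + z ≋ + b + + suc n) eq (shift-≋ (suc n) b)) (shift-≋ k b)
      (- + 1) (+ 1) (+ 0) (rearrange (+ b) (+ antipode⁻ b) (+ k))

  SignedOffset : ℕ → ℕ → ℕ → Set
  SignedOffset a b u = ∃[ z ] (+ b ≋ + a + z) × (z ≡ + u ⊎ z ≡ - + u)

  -- Quantifying over f says that the neighbours of the antipode of b lie at distances y and z from a,
  -- in either order.
  NeighboursAt : ℕ → ℕ → ℕ → ℕ → Set
  NeighboursAt a b y z = ∀ (f : ℕ → ℤ) → f (dist a (antipode⁺ b)) + f (dist a (antipode⁻ b)) ≡ f y + f z

  data AntipodalView (a b : ℕ) : Set where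
    at-self     : dist a b ≡ 0 → dist a (antipode b) ≡ n → NeighboursAt a b k k → AntipodalView a b
    at-antipode : dist a b ≡ n → dist a (antipode b) ≡ 0 → NeighboursAt a b 1 1 → AntipodalView a b
    in-between  : ∀ {v w} → v ℕ.< k → dist a b ≡ suc v → dist a (antipode b) ≡ suc w →
                  NeighboursAt a b w (suc (suc w)) → AntipodalView a b

  private
    offset⇒signed : ∀ {a b u} → Offset a b u → SignedOffset a b u
    offset⇒signed (inj₁ h) = _ , h , inj₁ refl
    offset⇒signed (inj₂ h) = _ , h , inj₂ refl

    shift-offset : ∀ {a b} z s → + b ≋ + a + z → + shift s b ≋ + a + (z + + s)
    shift-offset {a} {b} z s h = ≋-combine₂ (+ shift s b) (+ a + (z + + s)) (shift-≋ s b) h (+ 1) (+ 1) (+ 0)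
      (rearrange (+ shift s b) (+ b) (+ a) z (+ s) (+ p))
      where
      rearrange : ∀ S B A Z s P → S - (A + (Z + s)) ≡ + 1 * (S - (B + s)) + + 1 * (B - (A + Z)) + + 0 * P
      rearrange = solve-∀

    dist-by-signed-offset : ∀ {a c d} z → a ℕ.< p → c ℕ.< p → d ℕ.≤ n → + c ≋ + a + z →
                            (z ≋ + d ⊎ z ≋ - + d) → dist a c ≡ d
    dist-by-signed-offset {a} {c} {d} z a<p c<p d≤n h = dist-unique a<p c<p d≤n ∘ go
      where
      rearrange : ∀ C A Z D P → C - (A + D) ≡ + 1 * (C - (A + Z)) + + 1 * (Z - D) + + 0 * P
      rearrange = solve-∀
      go : z ≋ + d ⊎ z ≋ - + d → Offset a c d
      go (inj₁ z≋d)  = inj₁ (≋-combine₂ (+ c) (+ a + + d) h z≋d (+ 1) (+ 1) (+ 0) (rearrange (+ c) (+ a) z (+ d) (+ p)))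
      go (inj₂ z≋-d) = inj₂ (≋-combine₂ (+ c) (+ a - + d) h z≋-d (+ 1) (+ 1) (+ 0) (rearrange (+ c) (+ a) z (- + d) (+ p)))

    view-at-self : ∀ {a b} → a ℕ.< p → b ℕ.< p → dist a b ≡ 0 → + b ≋ + a + + 0 → AntipodalView a b
    view-at-self {a} {b} a<p b<p d≡0 h =
      at-self d≡0 (trans (dist-antipode a<p b<p) (cong (n ∸_) d≡0)) λ f → cong₂ (λ y z → f y + f z)
        (dist-by-signed-offset (+ suc n) a<p (shift<p (suc n) b) k≤n (shift-offset (+ 0) (suc n) h) (inj₂ (+ 1 , ring (+ k))))
        (dist-by-signed-offset (+ k) a<p (shift<p k b) k≤n (shift-offset (+ 0) k h) (inj₁ (+ 0 , ring′ (+ k))))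
      where
      ring : ∀ K → (+ 0 + (+ 2 + K)) - - K ≡ + 1 * ((+ 1 + K) + (+ 1 + K))
      ring = solve-∀
      ring′ : ∀ K → (+ 0 + K) - K ≡ + 0 * ((+ 1 + K) + (+ 1 + K))
      ring′ = solve-∀

    view-at-antipode : ∀ {a b} → a ℕ.< p → b ℕ.< p → dist a b ≡ n → SignedOffset a b n → AntipodalView a b
    view-at-antipode {a} {b} a<p b<p d≡n (z , h , z≡±n) =
      at-antipode d≡n (trans (dist-antipode a<p b<p) (trans (cong (n ∸_) d≡n) (ℕP.n∸n≡0 n))) λ f → cong₂ (λ y z → f y + f z)
        (dist-by-signed-offset (z + + suc n) a<p (shift<p (suc n) b) (s≤s z≤n) (shift-offset z (suc n) h) (inj₁ (plus z z≡±n)))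
        (dist-by-signed-offset (z + + k) a<p (shift<p k b) (s≤s z≤n) (shift-offset z k h) (inj₂ (minus z z≡±n)))
      where
      plus : ∀ z → z ≡ + n ⊎ z ≡ - + n → z + + suc n ≋ + 1
      plus _ (inj₁ refl) = + 1 , ring (+ k)
        where ring : ∀ K → ((+ 1 + K) + (+ 2 + K)) - + 1 ≡ + 1 * ((+ 1 + K) + (+ 1 + K))
              ring = solve-∀
      plus _ (inj₂ refl) = + 0 , ring (+ k)
        where ring : ∀ K → (- (+ 1 + K) + (+ 2 + K)) - + 1 ≡ + 0 * ((+ 1 + K) + (+ 1 + K))
              ring = solve-∀
      minus : ∀ z → z ≡ + n ⊎ z ≡ - + n → z + + k ≋ - + 1
      minus _ (inj₁ refl) = + 1 , ring (+ k)
        where ring : ∀ K → ((+ 1 + K) + K) - - + 1 ≡ + 1 * ((+ 1 + K) + (+ 1 + K))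
              ring = solve-∀
      minus _ (inj₂ refl) = + 0 , ring (+ k)
        where ring : ∀ K → (- (+ 1 + K) + K) - - + 1 ≡ + 0 * ((+ 1 + K) + (+ 1 + K))
              ring = solve-∀

    view-in-between : ∀ {a b v} → a ℕ.< p → b ℕ.< p → v ℕ.< k → dist a b ≡ suc v → SignedOffset a b (suc v) →
                      AntipodalView a b
    view-in-between {a} {b} {v} a<p b<p v<k d≡u (z , h , z≡±u) = in-between v<k d≡u
      (trans (dist-antipode a<p b<p) (trans (cong (n ∸_) d≡u) (ℕP.+-∸-assoc 1 v<k)))
      (neighbours z h z≡±u)
      where
      w : ℕ
      w = k ∸ suc v
      w≤n : w ℕ.≤ n
      w≤n = ℕP.≤-trans (ℕP.m∸n≤m k (suc v)) k≤n
      2+w≤n : suc (suc w) ℕ.≤ n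
      2+w≤n = subst (ℕ._≤ n) (cong suc (ℕP.+-∸-assoc 1 v<k)) (s≤s (ℕP.m∸n≤m k v))
      +w : + w ≡ + k - (+ 1 + + v)
      +w = +-∸ v<k
      ⁺<p : antipode⁺ b ℕ.< p
      ⁺<p = shift<p (suc n) b
      ⁻<p : antipode⁻ b ℕ.< p
      ⁻<p = shift<p k b
      neighbours : ∀ z → + b ≋ + a + z → z ≡ + suc v ⊎ z ≡ - + suc v → NeighboursAt a b w (suc (suc w))
      neighbours _ h (inj₁ refl) f = cong₂ (λ d⁺ d⁻ → f d⁺ + f d⁻) d⁺≡w d⁻≡2+w
        where
        ring : ∀ K U → ((+ 1 + U) + (+ 2 + K)) - - (K - (+ 1 + U)) ≡ + 1 * ((+ 1 + K) + (+ 1 + K))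
        ring = solve-∀
        ring′ : ∀ K U → ((+ 1 + U) + K) - - (+ 2 + (K - (+ 1 + U))) ≡ + 1 * ((+ 1 + K) + (+ 1 + K))
        ring′ = solve-∀
        d⁺≡w : dist a (antipode⁺ b) ≡ w
        d⁺≡w = dist-by-signed-offset (+ suc v + + suc n) a<p ⁺<p w≤n (shift-offset (+ suc v) (suc n) h)
          (inj₂ (+ 1 , subst (λ W → (+ suc v + + suc n) - - W ≡ + 1 * + p) (sym +w) (ring (+ k) (+ v))))
        d⁻≡2+w : dist a (antipode⁻ b) ≡ suc (suc w)
        d⁻≡2+w = dist-by-signed-offset (+ suc v + + k) a<p ⁻<p 2+w≤n (shift-offset (+ suc v) k h)
          (inj₂ (+ 1 , subst (λ W → (+ suc v + + k) - - (+ 2 + W) ≡ + 1 * + p) (sym +w) (ring′ (+ k) (+ v))))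
      neighbours _ h (inj₂ refl) f =
        trans (cong₂ (λ d⁺ d⁻ → f d⁺ + f d⁻) d⁺≡2+w d⁻≡w) (ℤP.+-comm (f (suc (suc w))) (f w))
        where
        ring : ∀ K U → (- (+ 1 + U) + (+ 2 + K)) - (+ 2 + (K - (+ 1 + U))) ≡ + 0 * ((+ 1 + K) + (+ 1 + K))
        ring = solve-∀
        ring′ : ∀ K U → (- (+ 1 + U) + K) - (K - (+ 1 + U)) ≡ + 0 * ((+ 1 + K) + (+ 1 + K))
        ring′ = solve-∀
        d⁺≡2+w : dist a (antipode⁺ b) ≡ suc (suc w)
        d⁺≡2+w = dist-by-signed-offset (- + suc v + + suc n) a<p ⁺<p 2+w≤n (shift-offset (- + suc v) (suc n) h)
          (inj₁ (+ 0 , subst (λ W → (- + suc v + + suc n) - (+ 2 + W) ≡ + 0 * + p) (sym +w) (ring (+ k) (+ v))))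
        d⁻≡w : dist a (antipode⁻ b) ≡ w
        d⁻≡w = dist-by-signed-offset (- + suc v + + k) a<p ⁻<p w≤n (shift-offset (- + suc v) k h)
          (inj₁ (+ 0 , subst (λ W → (- + suc v + + k) - W ≡ + 0 * + p) (sym +w) (ring′ (+ k) (+ v))))

  antipodal-view : ∀ {a b} → a ℕ.< p → b ℕ.< p → AntipodalView a b
  antipodal-view {a} {b} a<p b<p = classify (dist a b) refl (dist≤n a<p b<p) (offset⇒signed (dist-offset a<p b<p))
    where
    classify : ∀ u → dist a b ≡ u → u ℕ.≤ n → SignedOffset a b u → AntipodalView a b
    classify zero d≡0 _ (_ , h , inj₁ refl) = view-at-self a<p b<p d≡0 h
    classify zero d≡0 _ (_ , h , inj₂ refl) = view-at-self a<p b<p d≡0 h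
    classify (suc v) d≡u (s≤s v≤k) offset with ℕP.m≤n⇒m<n∨m≡n v≤k
    ... | inj₂ refl = view-at-antipode a<p b<p d≡u offset
    ... | inj₁ v<k  = view-in-between a<p b<p v<k d≡u offset

  dist-0-reflect : ∀ {e} → e ℕ.≤ p → dist 0 (p ∸ e) ≡ dist 0 e
  dist-0-reflect {e} e≤p = trans (cong ((p ∸ e) ⊓_) (ℕP.m∸[m∸n]≡n e≤p)) (ℕP.⊓-comm (p ∸ e) e)

  dist-below : ∀ {a t} → a ℕ.< p → t ℕ.≤ a → dist a t ≡ dist 0 (p ∸ a ℕ.+ t)
  dist-below {a} {t} a<p t≤a = begin
    dist a t                  ≡⟨ cong (λ e → e ⊓ (p ∸ e)) (ℕP.m≤n⇒∣n-m∣≡n∸m t≤a) ⟩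
    dist 0 (a ∸ t)            ≡⟨ dist-0-reflect (ℕP.≤-trans (ℕP.m∸n≤m a t) (ℕP.<⇒≤ a<p)) ⟨
    dist 0 (p ∸ (a ∸ t))      ≡⟨ cong (λ x → dist 0 (x ∸ (a ∸ t))) (ℕP.m∸n+n≡m (ℕP.<⇒≤ a<p)) ⟨
    dist 0 ((p ∸ a ℕ.+ a) ∸ (a ∸ t)) ≡⟨ cong (dist 0) (ℕP.+-∸-assoc (p ∸ a) (ℕP.m∸n≤m a t)) ⟩
    dist 0 (p ∸ a ℕ.+ (a ∸ (a ∸ t))) ≡⟨ cong (λ x → dist 0 (p ∸ a ℕ.+ x)) (ℕP.m∸[m∸n]≡n t≤a) ⟩
    dist 0 (p ∸ a ℕ.+ t)      ∎
    where open ≡-Reasoning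

  dist-above : ∀ a t → dist a (a ℕ.+ t) ≡ dist 0 t
  dist-above a t rewrite ℕP.∣m-m+n∣≡n a t = refl

  ∑-dist-translate : ∀ {a} → a ℕ.< p → (G : ℕ → ℤ) → ∑ p (λ t → G (dist a t)) ≡ ∑ p (λ t → G (dist 0 t))
  ∑-dist-translate {a} a<p G = begin
    ∑ p Gₐ                                          ≡⟨ cong (λ l → ∑ l Gₐ) (ℕP.m+[n∸m]≡n (ℕP.<⇒≤ a<p)) ⟨
    ∑ (a ℕ.+ (p ∸ a)) Gₐ                            ≡⟨ ∑-++ a (p ∸ a) Gₐ ⟩
    ∑ a Gₐ + ∑ (p ∸ a) (λ t → Gₐ (a ℕ.+ t))
      ≡⟨ cong₂ _+_ (∑-cong a (λ t t<a → cong G (dist-below a<p (ℕP.<⇒≤ t<a))))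
                   (∑-cong (p ∸ a) (λ t _ → cong G (dist-above a t))) ⟩
    ∑ a (λ t → G₀ (p ∸ a ℕ.+ t)) + ∑ (p ∸ a) G₀     ≡⟨ ℤP.+-comm (∑ a (λ t → G₀ (p ∸ a ℕ.+ t))) _ ⟩
    ∑ (p ∸ a) G₀ + ∑ a (λ t → G₀ (p ∸ a ℕ.+ t))     ≡⟨ ∑-++ (p ∸ a) a G₀ ⟨
    ∑ (p ∸ a ℕ.+ a) G₀                              ≡⟨ cong (λ l → ∑ l G₀) (ℕP.m∸n+n≡m (ℕP.<⇒≤ a<p)) ⟩
    ∑ p G₀                                          ∎
    where
    open ≡-Reasoning
    Gₐ G₀ : ℕ → ℤ
    Gₐ t = G (dist a t)
    G₀ t = G (dist 0 t)

  -- The vertices 0, 1, …, p − 1 lie at distances 0, 1, …, k, n, k, …, 1 from 0.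
  ∑-dist-0 : (G : ℕ → ℤ) → ∑ p (λ t → G (dist 0 t)) ≡ (G 0 + ∑ k (G ∘ suc)) + (G n + ∑ k (G ∘ suc))
  ∑-dist-0 G = begin
    ∑ (n ℕ.+ n) G₀                                          ≡⟨ ∑-++ n n G₀ ⟩
    (G₀ 0 + ∑ k (G₀ ∘ suc)) + (G₀ (n ℕ.+ 0) + ∑ k (λ t → G₀ (n ℕ.+ suc t)))
      ≡⟨ cong₂ (λ x y → (G 0 + x) + y) (∑-cong k (λ t t<k → cong G (near (s≤s (ℕP.<⇒≤ t<k)))))
           (cong₂ _+_ (cong G (far z≤n)) (∑-cong k (λ t t<k → cong G (far (s≤s (ℕP.<⇒≤ t<k)))))) ⟩
    (G 0 + ∑ k (G ∘ suc)) + (G n + ∑ k (λ t → G (n ∸ suc t)))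
      ≡⟨ cong (λ x → (G 0 + ∑ k (G ∘ suc)) + (G n + x)) (∑-cong k (λ t t<k → cong G (ℕP.+-∸-assoc 1 t<k))) ⟩
    (G 0 + ∑ k (G ∘ suc)) + (G n + ∑ k (λ t → G (suc (k ∸ suc t))))
      ≡⟨ cong (λ x → (G 0 + ∑ k (G ∘ suc)) + (G n + x)) (∑-reverse k (G ∘ suc)) ⟨
    (G 0 + ∑ k (G ∘ suc)) + (G n + ∑ k (G ∘ suc))           ∎
    where
    open ≡-Reasoning
    G₀ : ℕ → ℤ
    G₀ t = G (dist 0 t)
    near : ∀ {t} → t ℕ.≤ n → dist 0 t ≡ t
    near {t} t≤n = ℕP.m≤n⇒m⊓n≡m (ℕP.≤-trans t≤n (subst (n ℕ.≤_) (sym (ℕP.+-∸-assoc n t≤n)) (ℕP.m≤m+n n (n ∸ t))))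
    far : ∀ {s} → s ℕ.≤ n → dist 0 (n ℕ.+ s) ≡ n ∸ s
    far {s} s≤n = trans (cong ((n ℕ.+ s) ⊓_) (ℕP.[m+n]∸[m+o]≡n∸o n n s))
                        (ℕP.m≥n⇒m⊓n≡n (ℕP.≤-trans (ℕP.m∸n≤m n s) (ℕP.m≤m+n n s)))

module Inverse (m : ℕ) where
  open import Data.Integer using (_+_; _*_; _-_; -_)
  open Cycle m

  S : ℤ
  S = ∑ p (λ t → sq (dist 0 t))

  normaliser : ℤ
  normaliser = + 4 * + n * S

  -- The entries of 4nS·Δ̃⁻¹ = 2J + S·A by distance: b̄ is at distance n from b, b̄⁺ and b̄⁻ at distance k.
  entry : ℕ → ℤ
  entry u = + 2 + (+ 2 * S) * δ u n + (- S) * δ u k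

  ∑-δ-antipode : ∀ {b} → b ℕ.< p → (F : ℕ → ℤ) → ∑ p (λ t → δ (dist t b) n * F t) ≡ F (antipode b)
  ∑-δ-antipode {b} b<p F =
    trans (∑-single p _ (antipode b) (shift<p n b)
            (λ t t<p t≢b̄ → trans (cong (_* F t) (δ-≢ (t≢b̄ ∘ dist≡n⇒≡antipode t<p b<p))) (ℤP.*-zeroˡ (F t))))
          (trans (cong (λ d → δ d n * F (antipode b)) (dist-antipode-self b<p))
                 (trans (cong (_* F (antipode b)) (δ-refl n)) (ℤP.*-identityˡ (F (antipode b)))))

  ∑-δ-antipode± : ∀ {b} → b ℕ.< p → (F : ℕ → ℤ) →
                  ∑ p (λ t → δ (dist t b) k * F t) ≡ F (antipode⁺ b) + F (antipode⁻ b)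
  ∑-δ-antipode± {b} b<p F =
    trans (∑-pair p _ (antipode⁺ b) (antipode⁻ b) (shift<p (suc n) b) (shift<p k b) (antipode⁺≢antipode⁻ b)
            (λ t t<p t≢⁺ t≢⁻ → trans (cong (_* F t) (δ-≢ ([ t≢⁺ , t≢⁻ ]′ ∘ dist≡k⇒antipode± t<p b<p))) (ℤP.*-zeroˡ (F t))))
          (cong₂ _+_ (at (dist-antipode⁺-self b<p)) (at (dist-antipode⁻-self b<p)))
    where
    at : ∀ {t} → dist t b ≡ k → δ (dist t b) k * F t ≡ F t
    at {t} d≡k = trans (cong (λ d → δ d k * F t) d≡k) (trans (cong (_* F t) (δ-refl k)) (ℤP.*-identityˡ (F t)))

  ∑-*-entry : ∀ {b} → b ℕ.< p → (F : ℕ → ℤ) →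
              ∑ p (λ t → F t * entry (dist t b))
                ≡ + 2 * ∑ p F + S * (+ 2 * F (antipode b) - (F (antipode⁺ b) + F (antipode⁻ b)))
  ∑-*-entry {b} b<p F = begin
    ∑ p (λ t → F t * entry (dist t b))
      ≡⟨ ∑-cong p (λ t _ → expand (F t) S (δ (dist t b) n) (δ (dist t b) k)) ⟩
    ∑ p (λ t → + 2 * F t + ((+ 2 * S) * Fₙ t + (- S) * Fₖ t))
      ≡⟨ ∑-distrib-+ p (λ t → + 2 * F t) (λ t → (+ 2 * S) * Fₙ t + (- S) * Fₖ t) ⟩
    ∑ p (λ t → + 2 * F t) + ∑ p (λ t → (+ 2 * S) * Fₙ t + (- S) * Fₖ t)
      ≡⟨ cong₂ _+_ (*-distribˡ-∑ p (+ 2) F) (∑-distrib-+ p (λ t → (+ 2 * S) * Fₙ t) (λ t → (- S) * Fₖ t)) ⟩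
    + 2 * ∑ p F + (∑ p (λ t → (+ 2 * S) * Fₙ t) + ∑ p (λ t → (- S) * Fₖ t))
      ≡⟨ cong₂ (λ x y → + 2 * ∑ p F + (x + y))
           (trans (*-distribˡ-∑ p (+ 2 * S) Fₙ) (cong ((+ 2 * S) *_) (∑-δ-antipode b<p F)))
           (trans (*-distribˡ-∑ p (- S) Fₖ) (cong ((- S) *_) (∑-δ-antipode± b<p F))) ⟩
    + 2 * ∑ p F + ((+ 2 * S) * F (antipode b) + (- S) * (F (antipode⁺ b) + F (antipode⁻ b)))
      ≡⟨ collect (∑ p F) S (F (antipode b)) (F (antipode⁺ b) + F (antipode⁻ b)) ⟩
    + 2 * ∑ p F + S * (+ 2 * F (antipode b) - (F (antipode⁺ b) + F (antipode⁻ b))) ∎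
    where
    open ≡-Reasoning
    Fₙ Fₖ : ℕ → ℤ
    Fₙ t = δ (dist t b) n * F t
    Fₖ t = δ (dist t b) k * F t
    expand : ∀ f S x y → f * (+ 2 + (+ 2 * S) * x + (- S) * y) ≡ + 2 * f + ((+ 2 * S) * (x * f) + (- S) * (y * f))
    expand = solve-∀
    collect : ∀ σ S a b → + 2 * σ + ((+ 2 * S) * a + (- S) * b) ≡ + 2 * σ + S * (+ 2 * a - b)
    collect = solve-∀

  antipodal-difference : (ℕ → ℤ) → ℕ → ℕ → ℤ
  antipodal-difference f a b = + 2 * f (dist a (antipode b)) - (f (dist a (antipode⁺ b)) + f (dist a (antipode⁻ b)))

  antipodal-difference-≡ : ∀ f a b {x y z} → dist a (antipode b) ≡ x → NeighboursAt a b y z →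
                           antipodal-difference f a b ≡ + 2 * f x - (f y + f z)
  antipodal-difference-≡ f a b d̄≡x nbrs = cong₂ (λ x y → + 2 * f x - y) d̄≡x (nbrs f)

  ∑-sq-dist : ∀ {a} → a ℕ.< p → ∑ p (λ t → sq (dist a t)) ≡ S
  ∑-sq-dist a<p = ∑-dist-translate a<p sq

  Δ*entry : ∀ {a b} → a ℕ.< p → b ℕ.< p →
            ∑ p (λ t → sq (dist a t) * entry (dist t b)) ≡ normaliser * δ a b
  Δ*entry {a} {b} a<p b<p = trans (∑-*-entry b<p (λ t → sq (dist a t)))
    (trans (cong (λ σ → + 2 * σ + S * antipodal-difference sq a b) (∑-sq-dist a<p)) (evaluate (antipodal-view a<p b<p)))
    where
    a≢b : ∀ {d} → dist a b ≡ suc d → a ≢ b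
    a≢b d≡suc refl = ℕP.0≢1+n (trans (sym (dist-refl a)) d≡suc)
    evaluate : AntipodalView a b → + 2 * S + S * antipodal-difference sq a b ≡ normaliser * δ a b
    evaluate (at-self d≡0 d̄≡n nbrs) =
      trans (cong (λ Δ → + 2 * S + S * Δ) (antipodal-difference-≡ sq a b d̄≡n nbrs))
            (trans (ring S (+ k)) (cong (normaliser *_) (sym δab≡1)))
      where
      ring : ∀ S K → + 2 * S + S * (+ 2 * ((+ 1 + K) * (+ 1 + K)) - (K * K + K * K)) ≡ (+ 4 * (+ 1 + K) * S) * + 1
      ring = solve-∀
      δab≡1 : δ a b ≡ + 1
      δab≡1 = trans (cong (δ a) (sym (dist≡0⇒≡ a<p b<p d≡0))) (δ-refl a)
    evaluate (at-antipode d≡n d̄≡0 nbrs) =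
      trans (cong (λ Δ → + 2 * S + S * Δ) (antipodal-difference-≡ sq a b d̄≡0 nbrs))
            (trans (ring S (+ n)) (cong (normaliser *_) (sym (δ-≢ (a≢b d≡n)))))
      where
      ring : ∀ S N → + 2 * S + S * (+ 2 * (+ 0 * + 0) - (+ 1 * + 1 + + 1 * + 1)) ≡ (+ 4 * N * S) * 0ℤ
      ring = solve-∀
    evaluate (in-between {w = w} _ d≡suc d̄≡1+w nbrs) =
      trans (cong (λ Δ → + 2 * S + S * Δ) (antipodal-difference-≡ sq a b d̄≡1+w nbrs))
            (trans (ring S (+ n) (+ w)) (cong (normaliser *_) (sym (δ-≢ (a≢b d≡suc)))))
      where
      ring : ∀ S N W → + 2 * S + S * (+ 2 * ((+ 1 + W) * (+ 1 + W)) - (W * W + (+ 2 + W) * (+ 2 + W))) ≡ (+ 4 * N * S) * 0ℤ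
      ring = solve-∀

  X : ℕ → ℤ
  X d = sq (suc d)

  T : ℤ
  T = ∑ p (λ t → X (dist 0 t))

  -- 2x(ī) − x(ī⁺) − x(ī⁻) for x = (d(c,·) + 1)², as a function of d(c,i).
  weight : ℕ → ℤ
  weight d = - + 2 + (+ 4 * + suc n) * δ d 0 + (- + 4) * δ d n

  entry-row : ∀ {c i} → c ℕ.< p → i ℕ.< p →
              ∑ p (λ j → X (dist i c) * entry (dist i j) * X (dist j c)) ≡ X (dist c i) * (+ 2 * T + S * weight (dist c i))
  entry-row {c} {i} c<p i<p = begin
    ∑ p (λ j → X (dist i c) * entry (dist i j) * X (dist j c))
      ≡⟨ ∑-cong p (λ j _ → trans (reorder (X (dist i c)) (entry (dist i j)) (X (dist j c)))
                              (cong (λ d → X (dist i c) * (X (dist j c) * entry d)) (dist-sym i j))) ⟩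
    ∑ p (λ j → X (dist i c) * (X (dist j c) * entry (dist j i)))
      ≡⟨ *-distribˡ-∑ p (X (dist i c)) (λ j → X (dist j c) * entry (dist j i)) ⟩
    X (dist i c) * ∑ p (λ j → X (dist j c) * entry (dist j i))
      ≡⟨ cong₂ _*_ (cong X (dist-sym i c)) (∑-*-entry i<p (λ j → X (dist j c))) ⟩
    X (dist c i) * (+ 2 * ∑ p (λ j → X (dist j c)) + S * (+ 2 * X (dist (antipode i) c) - (X (dist (antipode⁺ i) c) + X (dist (antipode⁻ i) c))))
      ≡⟨ cong₂ (λ σ Δ → X (dist c i) * (+ 2 * σ + S * Δ)) ∑X≡T X-difference ⟩
    X (dist c i) * (+ 2 * T + S * antipodal-difference X c i)
      ≡⟨ cong (λ w → X (dist c i) * (+ 2 * T + S * w)) (evaluate (antipodal-view c<p i<p)) ⟩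
    X (dist c i) * (+ 2 * T + S * weight (dist c i)) ∎
    where
    open ≡-Reasoning
    reorder : ∀ x e y → x * e * y ≡ x * (y * e)
    reorder = solve-∀
    ∑X≡T : ∑ p (λ j → X (dist j c)) ≡ T
    ∑X≡T = trans (∑-cong p (λ j _ → cong X (dist-sym j c))) (∑-dist-translate c<p X)
    X-difference : + 2 * X (dist (antipode i) c) - (X (dist (antipode⁺ i) c) + X (dist (antipode⁻ i) c))
                   ≡ antipodal-difference X c i
    X-difference = cong₂ (λ x y → + 2 * X x - y) (dist-sym (antipode i) c)
                     (cong₂ (λ y z → X y + X z) (dist-sym (antipode⁺ i) c) (dist-sym (antipode⁻ i) c))
    evaluate : AntipodalView c i → antipodal-difference X c i ≡ weight (dist c i)
    evaluate (at-self d≡0 d̄≡n nbrs) rewrite d≡0 =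
      trans (antipodal-difference-≡ X c i d̄≡n nbrs) (ring (+ k))
      where
      ring : ∀ K → + 2 * ((+ 2 + K) * (+ 2 + K)) - ((+ 1 + K) * (+ 1 + K) + (+ 1 + K) * (+ 1 + K))
                   ≡ - + 2 + (+ 4 * (+ 2 + K)) * + 1 + (- + 4) * 0ℤ
      ring = solve-∀
    evaluate (at-antipode d≡n d̄≡0 nbrs) rewrite d≡n =
      trans (antipodal-difference-≡ X c i d̄≡0 nbrs)
            (trans (ring (+ k)) (cong (λ e → - + 2 + (+ 4 * + suc n) * 0ℤ + (- + 4) * e) (sym (δ-refl n))))
      where
      ring : ∀ K → + 2 * (+ 1 * + 1) - (+ 2 * + 2 + + 2 * + 2) ≡ - + 2 + (+ 4 * (+ 2 + K)) * 0ℤ + (- + 4) * + 1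
      ring = solve-∀
    evaluate (in-between {v} {w} v<k d≡suc d̄≡1+w nbrs) rewrite d≡suc =
      trans (antipodal-difference-≡ X c i d̄≡1+w nbrs)
            (trans (ring (+ k) (+ w)) (cong (λ e → - + 2 + (+ 4 * + suc n) * 0ℤ + (- + 4) * e) (sym (δ-≢ (ℕP.<⇒≢ (s≤s v<k))))))
      where
      ring : ∀ K W → + 2 * ((+ 2 + W) * (+ 2 + W)) - ((+ 1 + W) * (+ 1 + W) + (+ 3 + W) * (+ 3 + W))
                     ≡ - + 2 + (+ 4 * (+ 2 + K)) * 0ℤ + (- + 4) * 0ℤ
      ring = solve-∀

  row-value : ℕ → ℤ
  row-value d = X d * (+ 2 * T + S * weight d)

  row-value-0 : row-value 0 ≡ X 0 * (+ 2 * T + S * (+ 4 * + n + + 2))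
  row-value-0 = cong (λ w → X 0 * (+ 2 * T + S * w)) (ring (+ n))
    where
    ring : ∀ N → - + 2 + (+ 4 * (+ 1 + N)) * + 1 + (- + 4) * 0ℤ ≡ + 4 * N + + 2
    ring = solve-∀

  row-value-n : row-value n ≡ X n * (+ 2 * T + S * - + 6)
  row-value-n = cong (λ w → X n * (+ 2 * T + S * w))
    (trans (cong (λ e → - + 2 + (+ 4 * + suc n) * 0ℤ + (- + 4) * e) (δ-refl n)) (ring (+ n)))
    where
    ring : ∀ N → - + 2 + (+ 4 * (+ 1 + N)) * 0ℤ + (- + 4) * + 1 ≡ - + 6
    ring = solve-∀

  ∑-row-value-middle : ∑ k (row-value ∘ suc) ≡ (+ 2 * T + S * - + 2) * ∑ k (X ∘ suc)
  ∑-row-value-middle = begin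
    ∑ k (row-value ∘ suc)                          ≡⟨ ∑-cong k (λ t t<k → middle t (ℕP.<⇒≢ t<k)) ⟩
    ∑ k (λ t → (+ 2 * T + S * - + 2) * X (suc t)) ≡⟨ *-distribˡ-∑ k (+ 2 * T + S * - + 2) (X ∘ suc) ⟩
    (+ 2 * T + S * - + 2) * ∑ k (X ∘ suc)          ∎
    where
    open ≡-Reasoning
    ring : ∀ x c s N → x * (c + s * (- + 2 + (+ 4 * (+ 1 + N)) * 0ℤ + (- + 4) * 0ℤ)) ≡ (c + s * - + 2) * x
    ring = solve-∀
    middle : ∀ t → t ≢ k → row-value (suc t) ≡ (+ 2 * T + S * - + 2) * X (suc t)
    middle t t≢k = trans (cong (λ e → X (suc t) * (+ 2 * T + S * (- + 2 + (+ 4 * + suc n) * 0ℤ + (- + 4) * e)))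
                                (δ-≢ (t≢k ∘ ℕP.suc-injective)))
                         (ring (X (suc t)) (+ 2 * T) S (+ n))

  private
    1+K≡M⇒K≡M-1 : ∀ {K M} → + 1 * + 1 + K ≡ M → K ≡ M - + 1
    1+K≡M⇒K≡M-1 {K} eq = trans (ring K) (cong (_- + 1) eq)
      where
      ring : ∀ K → K ≡ (+ 1 * + 1 + K) - + 1
      ring = solve-∀

    -- T, S and K = ∑_{1 ≤ d < n} (d+1)² are determined by N = n and Q = ∑_{1 ≤ d < n} d².
    closed-form : ∀ {T S K Q} (N : ℤ) →
      T ≡ (+ 1 * + 1 + K) + ((+ 1 + N) * (+ 1 + N) + K) → S ≡ (+ 0 * + 0 + Q) + (N * N + Q) → K ≡ Q + N * N - + 1 →
      (+ 1 * + 1 * (+ 2 * T + S * (+ 4 * N + + 2)) + (+ 2 * T + S * - + 2) * K)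
        + ((+ 1 + N) * (+ 1 + N) * (+ 2 * T + S * - + 6) + (+ 2 * T + S * - + 2) * K)
        ≡ + 8 * (N * N) * ((+ 1 + N) * (+ 1 + N))
    closed-form {Q = Q} N refl refl refl = ring N Q
      where
      ring : ∀ N Q → let K = Q + N * N - + 1 ; T = (+ 1 * + 1 + K) + ((+ 1 + N) * (+ 1 + N) + K) ; S = (+ 0 * + 0 + Q) + (N * N + Q) in
        (+ 1 * + 1 * (+ 2 * T + S * (+ 4 * N + + 2)) + (+ 2 * T + S * - + 2) * K)
          + ((+ 1 + N) * (+ 1 + N) * (+ 2 * T + S * - + 6) + (+ 2 * T + S * - + 2) * K)
          ≡ + 8 * (N * N) * ((+ 1 + N) * (+ 1 + N))
      ring = solve-∀

  quadratic-form : ∀ {c} → c ℕ.< p →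
    ∑ p (λ i → ∑ p (λ j → X (dist i c) * entry (dist i j) * X (dist j c))) ≡ + 8 * sq n * sq (suc n)
  quadratic-form {c} c<p = begin
    ∑ p (λ i → ∑ p (λ j → X (dist i c) * entry (dist i j) * X (dist j c)))
      ≡⟨ ∑-cong p (λ i i<p → entry-row c<p i<p) ⟩
    ∑ p (λ i → row-value (dist c i))      ≡⟨ ∑-dist-translate c<p row-value ⟩
    ∑ p (λ i → row-value (dist 0 i))      ≡⟨ ∑-dist-0 row-value ⟩
    (row-value 0 + M) + (row-value n + M) ≡⟨ cong₂ (λ r₀ rₙ → (r₀ + M) + (rₙ + M)) row-value-0 row-value-n ⟩
    (X 0 * (+ 2 * T + S * (+ 4 * + n + + 2)) + M) + (X n * (+ 2 * T + S * - + 6) + M)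
      ≡⟨ cong (λ σ → (X 0 * (+ 2 * T + S * (+ 4 * + n + + 2)) + σ) + (X n * (+ 2 * T + S * - + 6) + σ)) ∑-row-value-middle ⟩
    (X 0 * (+ 2 * T + S * (+ 4 * + n + + 2)) + (+ 2 * T + S * - + 2) * K)
      + (X n * (+ 2 * T + S * - + 6) + (+ 2 * T + S * - + 2) * K)
      ≡⟨ closed-form {T} {S} {K} {∑ k (sq ∘ suc)} (+ n) (∑-dist-0 X) (∑-dist-0 sq)
                     (1+K≡M⇒K≡M-1 (∑-init-last k (sq ∘ suc))) ⟩
    + 8 * sq n * sq (suc n) ∎
    where
    open ≡-Reasoning
    M K : ℤ
    M = ∑ k (row-value ∘ suc)
    K = ∑ k (X ∘ suc)

  S-positive : 0ℤ ℤ.< S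
  S-positive = subst (0ℤ ℤ.<_) (sym (∑-dist-0 sq))
    (ℤP.+-mono-≤-< (ℤP.+-mono-≤ (ℤ.+≤+ z≤n) Q≥0) (ℤP.+-mono-<-≤ (ℤ.+<+ (s≤s z≤n)) Q≥0))
    where
    Q≥0 : 0ℤ ℤ.≤ ∑ k (sq ∘ suc)
    Q≥0 = ∑-nonneg k (sq ∘ suc) (λ _ _ → ℤ.+≤+ z≤n)

sumFin-cong : ∀ n {f g : Fin n → ℚ} → (∀ i → f i ≡ g i) → sumFin n f ≡ sumFin n g
sumFin-cong zero    eq = refl
sumFin-cong (suc n) eq = cong₂ ℚ._+_ (eq Fin.zero) (sumFin-cong n (λ i → eq (Fin.suc i)))

sumFin-/ : ∀ n (F : ℕ → ℤ) d .{{_ : ℕ.NonZero d}} → sumFin n (λ i → F (toℕ i) / d) ≡ ∑ n F / d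
sumFin-/ zero    F d = sym (ℚP.0/n≡0 d)
sumFin-/ (suc n) F d = trans (cong (F 0 / d ℚ.+_) (sumFin-/ n (λ t → F (suc t)) d)) (/-distrib-+ (F 0) _ d)

identity-sym : ∀ {n} (i j : Fin n) → identity n i j ≡ identity n j i
identity-sym i j with i Fin.≟ j | j Fin.≟ i
... | yes _   | yes _   = refl
... | no _    | no _    = refl
... | yes i≡j | no j≢i  = ⊥-elim (j≢i (sym i≡j))
... | no i≢j  | yes j≡i = ⊥-elim (i≢j (sym j≡i))

InverseWithPositivePendantForm : (p : ℕ) → Fin p → Set
InverseWithPositivePendantForm p c = Σ (Matrix p) (λ M →
  (∀ i j → (distSq p ⊗ M) i j ≡ identity p i j)
  × (∀ i j → (M ⊗ distSq p) i j ≡ identity p i j)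
  × (0ℚ < quadForm M (pendantVec p c)))

module EvenCycle (m : ℕ) where
  open Cycle m
  open Inverse m

  N : ℕ
  N = 4 ℕ.* n ℕ.* ℤ.∣ S ∣

  instance
    N≢0 : ℕ.NonZero N
    N≢0 = ℕP.m*n≢0 (4 ℕ.* n) ℤ.∣ S ∣ {{_}} {{positive⇒∣∣-nonZero S-positive}}

  +N : + N ≡ normaliser
  +N = trans (ℤP.pos-* (4 ℕ.* n) ℤ.∣ S ∣)
             (cong₂ ℤ._*_ (ℤP.pos-* 4 n) (ℤP.0≤i⇒+∣i∣≡i (ℤP.<⇒≤ S-positive)))

  inverse : Matrix p
  inverse i j = entry (dist (toℕ i) (toℕ j)) / N

  scaled-identity : ∀ (i j : Fin p) → (normaliser ℤ.* δ (toℕ i) (toℕ j)) / N ≡ identity p i j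
  scaled-identity i j = by (i Fin.≟ j)
    where
    by : (i≟j : Dec (i ≡ j)) → (normaliser ℤ.* δ (toℕ i) (toℕ j)) / N ≡ (if does i≟j then 1ℚ else 0ℚ)
    by (yes refl) = trans (cong (_/ N) (trans (cong (normaliser ℤ.*_) (δ-refl (toℕ i)))
                                               (trans (ℤP.*-identityʳ normaliser) (sym +N))))
                          (n/n≡1 N)
    by (no i≢j)  = trans (cong (_/ N) (trans (cong (normaliser ℤ.*_) (δ-≢ (i≢j ∘ FinP.toℕ-injective)))
                                               (ℤP.*-zeroʳ normaliser)))
                          (ℚP.0/n≡0 N)

  distSq⊗inverse : ∀ i j → (distSq p ⊗ inverse) i j ≡ identity p i j
  distSq⊗inverse i j = begin
    sumFin p (λ κ → ℕ→ℚ (dist (toℕ i) (toℕ κ) ℕ.* dist (toℕ i) (toℕ κ)) ℚ.* (entry (dist (toℕ κ) (toℕ j)) / N))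
      ≡⟨ sumFin-cong p (λ κ → term (toℕ κ) (toℕ j)) ⟩
    sumFin p (λ κ → F (toℕ κ) / N)         ≡⟨ sumFin-/ p F N ⟩
    ∑ p F / N                              ≡⟨ cong (_/ N) (Δ*entry (FinP.toℕ<n i) (FinP.toℕ<n j)) ⟩
    (normaliser ℤ.* δ (toℕ i) (toℕ j)) / N ≡⟨ scaled-identity i j ⟩
    identity p i j ∎
    where
    open ≡-Reasoning
    F : ℕ → ℤ
    F t = sq (dist (toℕ i) t) ℤ.* entry (dist t (toℕ j))
    term : ∀ t u → ℕ→ℚ (dist (toℕ i) t ℕ.* dist (toℕ i) t) ℚ.* (entry (dist t u) / N)
                   ≡ (sq (dist (toℕ i) t) ℤ.* entry (dist t u)) / N
    term t u = trans (/1-*-/ (+ (d ℕ.* d)) (entry (dist t u)) N) (cong (λ x → (x ℤ.* entry (dist t u)) / N) (ℤP.pos-* d d))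
      where
      d : ℕ
      d = dist (toℕ i) t

  inverse⊗distSq : ∀ i j → (inverse ⊗ distSq p) i j ≡ identity p i j
  inverse⊗distSq i j = begin
    sumFin p (λ κ → (entry (dist (toℕ i) (toℕ κ)) / N) ℚ.* ℕ→ℚ (dist (toℕ κ) (toℕ j) ℕ.* dist (toℕ κ) (toℕ j)))
      ≡⟨ sumFin-cong p (λ κ → term (toℕ κ)) ⟩
    sumFin p (λ κ → F (toℕ κ) / N)         ≡⟨ sumFin-/ p F N ⟩
    ∑ p F / N                              ≡⟨ cong (_/ N) (Δ*entry (FinP.toℕ<n j) (FinP.toℕ<n i)) ⟩
    (normaliser ℤ.* δ (toℕ j) (toℕ i)) / N ≡⟨ scaled-identity j i ⟩
    identity p j i                         ≡⟨ identity-sym j i ⟩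
    identity p i j ∎
    where
    open ≡-Reasoning
    F : ℕ → ℤ
    F t = sq (dist (toℕ j) t) ℤ.* entry (dist t (toℕ i))
    term : ∀ t → (entry (dist (toℕ i) t) / N) ℚ.* ℕ→ℚ (dist t (toℕ j) ℕ.* dist t (toℕ j)) ≡ F t / N
    term t = trans (/-*-/1 (entry (dist (toℕ i) t)) (+ (d ℕ.* d)) N)
      (cong (_/ N) (trans (ℤP.*-comm (entry (dist (toℕ i) t)) (+ (d ℕ.* d)))
                          (cong₂ ℤ._*_ (trans (ℤP.pos-* d d) (cong sq (dist-sym t (toℕ j))))
                                       (cong entry (dist-sym (toℕ i) t)))))
      where
      d : ℕ
      d = dist t (toℕ j)

  quadForm-inverse : ∀ c → quadForm inverse (pendantVec p c) ≡ (+ 8 ℤ.* sq n ℤ.* sq (suc n)) / N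
  quadForm-inverse c = begin
    sumFin p (λ i → sumFin p (λ j → x i ℚ.* inverse i j ℚ.* x j))
      ≡⟨ sumFin-cong p (λ i → sumFin-cong p (λ j → term (toℕ i) (toℕ j))) ⟩
    sumFin p (λ i → sumFin p (λ j → Q (toℕ i) (toℕ j) / N))
      ≡⟨ sumFin-cong p (λ i → sumFin-/ p (Q (toℕ i)) N) ⟩
    sumFin p (λ i → ∑ p (Q (toℕ i)) / N)   ≡⟨ sumFin-/ p (λ s → ∑ p (Q s)) N ⟩
    ∑ p (λ s → ∑ p (Q s)) / N               ≡⟨ cong (_/ N) (quadratic-form (FinP.toℕ<n c)) ⟩
    (+ 8 ℤ.* sq n ℤ.* sq (suc n)) / N ∎
    where
    open ≡-Reasoning
    x : Vector p
    x = pendantVec p c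
    Q : ℕ → ℕ → ℤ
    Q s t = X (dist s (toℕ c)) ℤ.* entry (dist s t) ℤ.* X (dist t (toℕ c))
    +X : ∀ d → + (suc d ℕ.* suc d) ≡ X d
    +X d = ℤP.pos-* (suc d) (suc d)
    term : ∀ s t → ℕ→ℚ (suc (dist s (toℕ c)) ℕ.* suc (dist s (toℕ c))) ℚ.* (entry (dist s t) / N)
                       ℚ.* ℕ→ℚ (suc (dist t (toℕ c)) ℕ.* suc (dist t (toℕ c)))
                   ≡ Q s t / N
    term s t = begin
      (+ (suc dₛ ℕ.* suc dₛ) / 1) ℚ.* (entry (dist s t) / N) ℚ.* (+ (suc dₜ ℕ.* suc dₜ) / 1)
        ≡⟨ cong (ℚ._* (+ (suc dₜ ℕ.* suc dₜ) / 1)) (/1-*-/ (+ (suc dₛ ℕ.* suc dₛ)) (entry (dist s t)) N) ⟩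
      ((+ (suc dₛ ℕ.* suc dₛ) ℤ.* entry (dist s t)) / N) ℚ.* (+ (suc dₜ ℕ.* suc dₜ) / 1)
        ≡⟨ /-*-/1 (+ (suc dₛ ℕ.* suc dₛ) ℤ.* entry (dist s t)) (+ (suc dₜ ℕ.* suc dₜ)) N ⟩
      ((+ (suc dₛ ℕ.* suc dₛ) ℤ.* entry (dist s t)) ℤ.* + (suc dₜ ℕ.* suc dₜ)) / N
        ≡⟨ cong₂ (λ a b → (a ℤ.* entry (dist s t) ℤ.* b) / N) (+X dₛ) (+X dₜ) ⟩
      Q s t / N ∎
      where
      dₛ dₜ : ℕ
      dₛ = dist s (toℕ c)
      dₜ = dist t (toℕ c)

  inverse-with-positive-pendant-form : (c : Fin p) → InverseWithPositivePendantForm p c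
  inverse-with-positive-pendant-form c = inverse , distSq⊗inverse , inverse⊗distSq ,
    subst (0ℚ <_) (sym (quadForm-inverse c)) (positive-/ (+ 8 ℤ.* sq n ℤ.* sq (suc n)) N (ℤ.+<+ (s≤s z≤n)))

mainTheorem8 : (p : ℕ) → 4 ≤ p → 2 ∣ p → (c : Fin p) →
    Σ (Matrix p) (λ M →
    (∀ i j → (distSq p ⊗ M) i j ≡ identity p i j)
    × (∀ i j → (M ⊗ distSq p) i j ≡ identity p i j)
    × (0ℚ < quadForm M (pendantVec p c)))
mainTheorem8 p 4≤p (divides zero          p≡0)  = ⊥-elim (ℕP.<⇒≱ (s≤s z≤n) (subst (4 ≤_) p≡0 4≤p))
mainTheorem8 p 4≤p (divides (suc zero)    p≡2)  = ⊥-elim (ℕP.<⇒≱ (s≤s (s≤s (s≤s z≤n))) (subst (4 ≤_) p≡2 4≤p))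
mainTheorem8 p 4≤p (divides (suc (suc m)) p≡2n) =
  subst (λ p → (c : Fin p) → InverseWithPositivePendantForm p c) (sym p≡n+n) (EvenCycle.inverse-with-positive-pendant-form m)
  where
  p≡n+n : p ≡ suc (suc m) ℕ.+ suc (suc m)
  p≡n+n = trans p≡2n (trans (ℕP.*-comm (suc (suc m)) 2) (cong (suc (suc m) ℕ.+_) (ℕP.+-identityʳ (suc (suc m)))))
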